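{- Let $n, k, \ell$ be integers with $n > k + \ell$, $k \geq \ell \geq 2$ and $k \geq 3$. Suppose that $\mathcal F \subset \binom{[n]}{k}$ and $\mathcal G \subset \binom{[2\ell]}{\ell}$ are non-trivial and cross-intersecting. Then $$|\mathcal F| + |\mathcal G| \leq \binom{n}{k} - 2\binom{n-\ell}{k} + \binom{n-2\ell}{k} + 2,$$ and the inequality is strict unless $|\mathcal G| = 2$.
   Context: $[m] = \{1,\dots,m\}$ and $\binom{[m]}{r}$ is the collection of $r$-element subsets of $[m]$; here $[2\ell] \subset [n]$. Families $\mathcal F, \mathcal G$ are cross-intersecting if $F \cap G \neq \emptyset$ for all $F \in \mathcal F$, $G \in \mathcal G$. A family $\mathcal F$ is non-trivial if $\bigcap_{F \in \mathcal F} F = \emptyset$. -}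

module Defs where

open import Data.Nat using (ℕ; _<_; _*_)
open import Data.Fin using (Fin; toℕ)
open import Data.Fin.Subset using (Subset; _∈_; _∉_; _∩_; ∣_∣; Nonempty)
open import Data.List using (List; length)
open import Data.List.Relation.Unary.All using (All)
open import Data.List.Relation.Unary.Unique.Propositional using (Unique)
import Data.List.Membership.Propositional as L
open import Data.Product using (∃; _×_)
open import Relation.Binary.PropositionalEquality using (_≡_)

record Family (n : ℕ) : Set where
  constructor family
  field
    members : List (Subset n)
    unique  : Unique members
open Family public

card : ∀ {n} → Family n → ℕ
card 𝓕 = length (members 𝓕)

Uniform : ∀ {n} → ℕ → Family n → Set
Uniform k 𝓕 = All (λ F → ∣ F ∣ ≡ k) (members 𝓕)

WithinFirst : ∀ {n} → ℕ → Family n → Set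
WithinFirst m 𝓕 = All (λ F → ∀ i → i ∈ F → toℕ i < m) (members 𝓕)

NonTrivial : ∀ {n} → Family n → Set
NonTrivial {n} 𝓕 = ∀ (i : Fin n) → ∃ λ F → F L.∈ members 𝓕 × i ∉ F

CrossIntersecting : ∀ {n} → Family n → Family n → Set
CrossIntersecting 𝓕 𝓖 =
  ∀ F G → F L.∈ members 𝓕 → G L.∈ members 𝓖 → Nonempty (F ∩ G)

{-# OPTIONS --safe #-}
module Submission where

-- Write n = 2ℓ + m and let 𝒞 be the family of complements in [2ℓ] of the members of 𝓖: it is an
-- ℓ-uniform family covering [2ℓ], and a k-set in 𝓕 meets every member of 𝓖, so its trace on [2ℓ]
-- lies below no member of 𝒞. A trace S extends to C(m, k - |S|) k-subsets of [n], so |𝓕| is at most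
-- the weighted number of traces not below 𝒞, and the claim becomes a lower bound for the weighted
-- number of sets below 𝒞. Level by level: the j-sets below a fixed C₁ ∈ 𝒞 number C(ℓ, j), and there
-- are at least as many below 𝒞 but not below C₁, by double counting their incidences with the
-- complement D of C₁, each point of which lies in some member of 𝒞; at level ℓ the members of 𝒞
-- themselves give |𝒞| ≥ 2 sets. If |𝒞| ≥ 3, the inequality is strict at level ℓ when ℓ < k, and at
-- level ℓ - 1 when ℓ = k: a third member minus a suitable point is a new (ℓ - 1)-set meeting C₁.

open import Defs
open import Function.Base using (_∘_)
open import Level using (0ℓ)
open import Data.Bool.Base using (Bool; true; false; not; T)
import Data.Bool.Properties as Bool
open import Data.Nat.Base
  using (ℕ; zero; suc; pred; _+_; _*_; _∸_; _<_; _≤_; _≡ᵇ_; z≤n; s≤s; s≤s⁻¹;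
         NonZero; >-nonZero; >-nonZero⁻¹; ≢-nonZero⁻¹)
open import Data.Nat.Properties
open import Data.Nat.Combinatorics using (_C_; nCk+nC[k+1]≡[n+1]C[k+1]; nCn≡1; nC1≡n)
open import Data.Nat.Tactic.RingSolver using (solve-∀)
open import Algebra.Properties.CommutativeSemigroup +-commutativeSemigroup
  using () renaming (interchange to +-interchange)
open import Algebra.Properties.CommutativeSemigroup *-commutativeSemigroup
  using () renaming (x∙yz≈y∙xz to *-x∙yz≈y∙xz)
open import Data.Fin.Base using (Fin; zero; suc; fromℕ<; toℕ; _↑ˡ_)
open import Data.Fin.Subset using (Subset; ∣_∣; _∈_; _∉_; _⊆_; _⊈_; _∩_; ∁; ⊤; ⊥; _-_)
open import Data.Fin.Subset.Properties
  using (_∈?_; _⊆?_; nonempty?; drop-∷-⊆; s⊆s; out⊆; ⊆-refl; ⊆-trans; ⊆⊤; ⊥⊆; ∉⊥; Empty-unique;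
         p⊆q⇒∣p∣≤∣q∣; ∣p∣≤n; ∣⊤∣≡n; ∣⊥∣≡0; ∣∁p∣≡n∸∣p∣; ∣p∩q∣≤∣p∣; p─⊥≡p; p─q⊆p;
         x∈p∧x≢y⇒x∈p-y; x∈p∩q⁻; x∈p⇒x∉∁p; x∈∁p⇒x∉p; x∉p⇒x∈∁p)
open import Data.Vec.Base using (Vec; []; _∷_; _++_; take; drop; here; there)
open import Data.Vec.Properties using (map-∘; map-cong; map-id; ≡-dec; take++drop≡id)
open import Data.List.Base using (List; []; _∷_; length; map)
open import Data.List.Properties using (length-map)
open import Data.List.Relation.Unary.Any as Any using (Any; any?)
open import Data.List.Relation.Unary.All using ([]; _∷_)
import Data.List.Relation.Unary.All as All
import Data.List.Relation.Unary.All.Properties as Allₚ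
open import Data.List.Relation.Unary.AllPairs using ([]; _∷_)
open import Data.List.Relation.Unary.Unique.Propositional using (Unique)
import Data.List.Membership.Propositional as L
open import Data.List.Membership.Propositional using (lose; find)
open import Data.List.Membership.Propositional.Properties using (∈-map⁺; ∈-map⁻)
open import Data.Product using (∃; _×_; _,_; proj₁; proj₂)
open import Data.Sum using (_⊎_; inj₁; inj₂)
open import Relation.Nullary using (¬_; Dec; does; yes; no; contradiction)
open import Relation.Unary using (Pred; Decidable)
open import Relation.Unary.Properties using (U?; _∩?_; ∁?)
open import Relation.Binary.Definitions using (DecidableEquality)
open import Relation.Binary.PropositionalEquality

𝟙 : Bool → ℕ
𝟙 true  = 1
𝟙 false = 0

≡ᵇ≡true⇒≡ : ∀ {m n} → (m ≡ᵇ n) ≡ true → m ≡ n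
≡ᵇ≡true⇒≡ {m} {n} eq = ≡ᵇ⇒≡ m n (subst T (sym eq) _)

≡ᵇ≡false⇒≢ : ∀ {m n} → (m ≡ᵇ n) ≡ false → m ≢ n
≡ᵇ≡false⇒≢ {m} {n} eq m≡n = subst T eq (≡⇒≡ᵇ m n m≡n)

≡ᵇ-refl : ∀ n → (n ≡ᵇ n) ≡ true
≡ᵇ-refl zero    = refl
≡ᵇ-refl (suc n) = ≡ᵇ-refl n

≡ᵇ-comm : ∀ m n → (m ≡ᵇ n) ≡ (n ≡ᵇ m)
≡ᵇ-comm zero    zero    = refl
≡ᵇ-comm zero    (suc n) = refl
≡ᵇ-comm (suc m) zero    = refl
≡ᵇ-comm (suc m) (suc n) = ≡ᵇ-comm m n

δ-≢ : ∀ {j a} c → j ≢ a → 𝟙 (j ≡ᵇ a) * c ≡ 0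
δ-≢ {j} {a} c j≢a with j ≡ᵇ a in eq
... | true  = contradiction (≡ᵇ≡true⇒≡ eq) j≢a
... | false = refl

δ-≡ : ∀ a c → 𝟙 (a ≡ᵇ a) * c ≡ c
δ-≡ a c rewrite ≡ᵇ-refl a = +-identityʳ c

∑ₛ : ∀ N → (Subset N → ℕ) → ℕ
∑ₛ zero    f = f []
∑ₛ (suc N) f = ∑ₛ N (f ∘ (false ∷_)) + ∑ₛ N (f ∘ (true ∷_))

∑ᶠ : ∀ N → (Fin N → ℕ) → ℕ
∑ᶠ zero    f = 0
∑ᶠ (suc N) f = f zero + ∑ᶠ N (f ∘ suc)

∑< : ℕ → (ℕ → ℕ) → ℕ
∑< zero    f = 0
∑< (suc B) f = ∑< B f + f B

∑ₛ-cong : ∀ {N} {f g : Subset N → ℕ} → (∀ S → f S ≡ g S) → ∑ₛ N f ≡ ∑ₛ N g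
∑ₛ-cong {zero}  f≗g = f≗g []
∑ₛ-cong {suc N} f≗g = cong₂ _+_ (∑ₛ-cong (f≗g ∘ (false ∷_))) (∑ₛ-cong (f≗g ∘ (true ∷_)))

∑ₛ-mono-≤ : ∀ {N} {f g : Subset N → ℕ} → (∀ S → f S ≤ g S) → ∑ₛ N f ≤ ∑ₛ N g
∑ₛ-mono-≤ {zero}  f≤g = f≤g []
∑ₛ-mono-≤ {suc N} f≤g = +-mono-≤ (∑ₛ-mono-≤ (f≤g ∘ (false ∷_))) (∑ₛ-mono-≤ (f≤g ∘ (true ∷_)))

∑ₛ-mono-< : ∀ {N} {f g : Subset N → ℕ} → (∀ S → f S ≤ g S) → ∀ S₀ → f S₀ < g S₀ → ∑ₛ N f < ∑ₛ N g
∑ₛ-mono-< {zero}  f≤g []          f<g = f<g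
∑ₛ-mono-< {suc N} f≤g (false ∷ S) f<g =
  +-mono-<-≤ (∑ₛ-mono-< (f≤g ∘ (false ∷_)) S f<g) (∑ₛ-mono-≤ (f≤g ∘ (true ∷_)))
∑ₛ-mono-< {suc N} f≤g (true ∷ S)  f<g =
  +-mono-≤-< (∑ₛ-mono-≤ (f≤g ∘ (false ∷_))) (∑ₛ-mono-< (f≤g ∘ (true ∷_)) S f<g)

term≤∑ₛ : ∀ {N} (f : Subset N → ℕ) S → f S ≤ ∑ₛ N f
term≤∑ₛ {zero}  f []          = ≤-refl
term≤∑ₛ {suc N} f (false ∷ S) = ≤-trans (term≤∑ₛ (f ∘ (false ∷_)) S) (m≤m+n _ _)
term≤∑ₛ {suc N} f (true ∷ S)  = ≤-trans (term≤∑ₛ (f ∘ (true ∷_)) S) (m≤n+m _ _)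

∑ₛ-zero : ∀ N → ∑ₛ N (λ _ → 0) ≡ 0
∑ₛ-zero zero    = refl
∑ₛ-zero (suc N) = cong₂ _+_ (∑ₛ-zero N) (∑ₛ-zero N)

∑ₛ-distrib-+ : ∀ {N} (f g : Subset N → ℕ) → ∑ₛ N (λ S → f S + g S) ≡ ∑ₛ N f + ∑ₛ N g
∑ₛ-distrib-+ {zero}  f g = refl
∑ₛ-distrib-+ {suc N} f g = trans
  (cong₂ _+_ (∑ₛ-distrib-+ (f ∘ (false ∷_)) (g ∘ (false ∷_)))
             (∑ₛ-distrib-+ (f ∘ (true ∷_)) (g ∘ (true ∷_))))
  (+-interchange (∑ₛ N (f ∘ (false ∷_))) (∑ₛ N (g ∘ (false ∷_))) (∑ₛ N (f ∘ (true ∷_))) _)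

∑ₛ-distribˡ-* : ∀ {N} c (f : Subset N → ℕ) → ∑ₛ N (λ S → c * f S) ≡ c * ∑ₛ N f
∑ₛ-distribˡ-* {zero}  c f = refl
∑ₛ-distribˡ-* {suc N} c f =
  trans (cong₂ _+_ (∑ₛ-distribˡ-* c (f ∘ (false ∷_))) (∑ₛ-distribˡ-* c (f ∘ (true ∷_))))
        (sym (*-distribˡ-+ c _ _))

∑ₛ-++ : ∀ N {m} (f : Subset (N + m) → ℕ) → ∑ₛ (N + m) f ≡ ∑ₛ N (λ S → ∑ₛ m (λ R → f (S ++ R)))
∑ₛ-++ zero    f = refl
∑ₛ-++ (suc N) f = cong₂ _+_ (∑ₛ-++ N _) (∑ₛ-++ N _)

∑ᶠ-cong : ∀ {N} {f g : Fin N → ℕ} → (∀ i → f i ≡ g i) → ∑ᶠ N f ≡ ∑ᶠ N g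
∑ᶠ-cong {zero}  f≗g = refl
∑ᶠ-cong {suc N} f≗g = cong₂ _+_ (f≗g zero) (∑ᶠ-cong (f≗g ∘ suc))

∑ᶠ-mono-≤ : ∀ {N} {f g : Fin N → ℕ} → (∀ i → f i ≤ g i) → ∑ᶠ N f ≤ ∑ᶠ N g
∑ᶠ-mono-≤ {zero}  f≤g = z≤n
∑ᶠ-mono-≤ {suc N} f≤g = +-mono-≤ (f≤g zero) (∑ᶠ-mono-≤ (f≤g ∘ suc))

∑ᶠ-distribˡ-* : ∀ {N} c (f : Fin N → ℕ) → ∑ᶠ N (λ i → c * f i) ≡ c * ∑ᶠ N f
∑ᶠ-distribˡ-* {zero}  c f = sym (*-zeroʳ c)
∑ᶠ-distribˡ-* {suc N} c f =
  trans (cong (c * f zero +_) (∑ᶠ-distribˡ-* c (f ∘ suc))) (sym (*-distribˡ-+ c _ _))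

∑<-cong : ∀ B {f g : ℕ → ℕ} → (∀ j → f j ≡ g j) → ∑< B f ≡ ∑< B g
∑<-cong zero    f≗g = refl
∑<-cong (suc B) f≗g = cong₂ _+_ (∑<-cong B f≗g) (f≗g B)

∑<-mono-≤ : ∀ B {f g : ℕ → ℕ} → (∀ j → f j ≤ g j) → ∑< B f ≤ ∑< B g
∑<-mono-≤ zero    f≤g = z≤n
∑<-mono-≤ (suc B) f≤g = +-mono-≤ (∑<-mono-≤ B f≤g) (f≤g B)

∑<-mono-< : ∀ B {f g : ℕ → ℕ} → (∀ j → f j ≤ g j) → ∀ {j₀} → j₀ < B → f j₀ < g j₀ → ∑< B f < ∑< B g
∑<-mono-< (suc B) f≤g {j₀} j₀<1+B f<g with m≤n⇒m<n∨m≡n (s≤s⁻¹ j₀<1+B)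
... | inj₁ j₀<B = +-mono-<-≤ (∑<-mono-< B f≤g j₀<B f<g) (f≤g B)
... | inj₂ refl = +-mono-≤-< (∑<-mono-≤ B f≤g) f<g

∑<-distrib-+ : ∀ B (f g : ℕ → ℕ) → ∑< B (λ j → f j + g j) ≡ ∑< B f + ∑< B g
∑<-distrib-+ zero    f g = refl
∑<-distrib-+ (suc B) f g =
  trans (cong (_+ (f B + g B)) (∑<-distrib-+ B f g)) (+-interchange (∑< B f) (∑< B g) (f B) (g B))

∑<-distribˡ-* : ∀ B c (f : ℕ → ℕ) → ∑< B (λ j → c * f j) ≡ c * ∑< B f
∑<-distribˡ-* zero    c f = sym (*-zeroʳ c)
∑<-distribˡ-* (suc B) c f =
  trans (cong (_+ c * f B) (∑<-distribˡ-* B c f)) (sym (*-distribˡ-+ c _ _))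

∑<-δ-vanish : ∀ B {a} c → B ≤ a → ∑< B (λ j → 𝟙 (j ≡ᵇ a) * c) ≡ 0
∑<-δ-vanish zero        c _     = refl
∑<-δ-vanish (suc B) {a} c 1+B≤a = cong₂ _+_ (∑<-δ-vanish B c (<⇒≤ 1+B≤a)) (δ-≢ c (<⇒≢ 1+B≤a))

∑<-δ : ∀ B {a} c → a < B → ∑< B (λ j → 𝟙 (j ≡ᵇ a) * c) ≡ c
∑<-δ (suc B) {a} c a<1+B with B ≡ᵇ a in eq
... | true  = cong₂ _+_ (∑<-δ-vanish B c (≤-reflexive (≡ᵇ≡true⇒≡ eq))) (+-identityʳ c)
... | false = trans (+-identityʳ _) (∑<-δ B c (≤∧≢⇒< (s≤s⁻¹ a<1+B) (≡ᵇ≡false⇒≢ eq ∘ sym)))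

∑ₛ-∑ᶠ-comm : ∀ {N M} (f : Fin N → Subset M → ℕ) →
             ∑ₛ M (λ S → ∑ᶠ N (λ i → f i S)) ≡ ∑ᶠ N (λ i → ∑ₛ M (f i))
∑ₛ-∑ᶠ-comm {zero}  {M} f = ∑ₛ-zero M
∑ₛ-∑ᶠ-comm {suc N} {M} f =
  trans (∑ₛ-distrib-+ (f zero) _) (cong (∑ₛ M (f zero) +_) (∑ₛ-∑ᶠ-comm (f ∘ suc)))

∑ₛ-∑<-comm : ∀ B {M} (f : ℕ → Subset M → ℕ) →
             ∑ₛ M (λ S → ∑< B (λ j → f j S)) ≡ ∑< B (λ j → ∑ₛ M (f j))
∑ₛ-∑<-comm zero    {M} f = ∑ₛ-zero M
∑ₛ-∑<-comm (suc B) {M} f =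
  trans (∑ₛ-distrib-+ _ (f B)) (cong (_+ ∑ₛ M (f B)) (∑ₛ-∑<-comm B f))

∣++∣ : ∀ {N m} (S : Subset N) (R : Subset m) → ∣ S ++ R ∣ ≡ ∣ S ∣ + ∣ R ∣
∣++∣ []          R = refl
∣++∣ (false ∷ S) R = ∣++∣ S R
∣++∣ (true ∷ S)  R = cong suc (∣++∣ S R)

∁-involutive : ∀ {N} (X : Subset N) → ∁ (∁ X) ≡ X
∁-involutive X = trans (sym (map-∘ not not X)) (trans (map-cong Bool.not-involutive X) (map-id X))

∣∁∣≡half : ∀ {ℓ} (X : Subset (2 * ℓ)) → ∣ X ∣ ≡ ℓ → ∣ ∁ X ∣ ≡ ℓ
∣∁∣≡half {ℓ} X ∣X∣≡ℓ = begin
  ∣ ∁ X ∣        ≡⟨ ∣∁p∣≡n∸∣p∣ X ⟩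
  2 * ℓ ∸ ∣ X ∣  ≡⟨ cong (2 * ℓ ∸_) ∣X∣≡ℓ ⟩
  2 * ℓ ∸ ℓ      ≡⟨ m+n∸m≡n ℓ (ℓ + 0) ⟩
  ℓ + 0          ≡⟨ +-identityʳ ℓ ⟩
  ℓ              ∎
  where open ≡-Reasoning

∣∩∣+∣∩∁∣ : ∀ {N} (S X : Subset N) → ∣ S ∩ X ∣ + ∣ S ∩ ∁ X ∣ ≡ ∣ S ∣
∣∩∣+∣∩∁∣ []          []          = refl
∣∩∣+∣∩∁∣ (false ∷ S) (_ ∷ X)     = ∣∩∣+∣∩∁∣ S X
∣∩∣+∣∩∁∣ (true ∷ S)  (false ∷ X) = trans (+-suc _ _) (cong suc (∣∩∣+∣∩∁∣ S X))
∣∩∣+∣∩∁∣ (true ∷ S)  (true ∷ X)  = cong suc (∣∩∣+∣∩∁∣ S X)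

⊆⇒∣∩∁∣≡0 : ∀ {N} {S X : Subset N} → S ⊆ X → ∣ S ∩ ∁ X ∣ ≡ 0
⊆⇒∣∩∁∣≡0 {S = []}        {[]}        S⊆X = refl
⊆⇒∣∩∁∣≡0 {S = false ∷ S} {_ ∷ X}     S⊆X = ⊆⇒∣∩∁∣≡0 (drop-∷-⊆ S⊆X)
⊆⇒∣∩∁∣≡0 {S = true ∷ S}  {false ∷ X} S⊆X with () ← S⊆X here
⊆⇒∣∩∁∣≡0 {S = true ∷ S}  {true ∷ X}  S⊆X = ⊆⇒∣∩∁∣≡0 (drop-∷-⊆ S⊆X)

∣∩∁∣≡0⇒⊆ : ∀ {N} {S X : Subset N} → ∣ S ∩ ∁ X ∣ ≡ 0 → S ⊆ X
∣∩∁∣≡0⇒⊆ {S = false ∷ S} {_ ∷ X}    eq (there i∈S) = there (∣∩∁∣≡0⇒⊆ eq i∈S)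
∣∩∁∣≡0⇒⊆ {S = true ∷ S}  {true ∷ X} eq here        = here
∣∩∁∣≡0⇒⊆ {S = true ∷ S}  {true ∷ X} eq (there i∈S) = there (∣∩∁∣≡0⇒⊆ eq i∈S)

⊆⇒∣∩∣≡∣∣ : ∀ {N} {S X : Subset N} → S ⊆ X → ∣ S ∩ X ∣ ≡ ∣ S ∣
⊆⇒∣∩∣≡∣∣ {S = S} {X} S⊆X =
  trans (sym (+-identityʳ _)) (trans (cong (∣ S ∩ X ∣ +_) (sym (⊆⇒∣∩∁∣≡0 S⊆X))) (∣∩∣+∣∩∁∣ S X))

⊆∧∣∣≤⇒≡ : ∀ {N} {S X : Subset N} → S ⊆ X → ∣ X ∣ ≤ ∣ S ∣ → S ≡ X
⊆∧∣∣≤⇒≡ {S = []}        {[]}        _   _   = refl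
⊆∧∣∣≤⇒≡ {S = false ∷ S} {false ∷ X} S⊆X X≤S = cong (false ∷_) (⊆∧∣∣≤⇒≡ (drop-∷-⊆ S⊆X) X≤S)
⊆∧∣∣≤⇒≡ {S = false ∷ S} {true ∷ X}  S⊆X X≤S = contradiction (p⊆q⇒∣p∣≤∣q∣ (drop-∷-⊆ S⊆X)) (<⇒≱ X≤S)
⊆∧∣∣≤⇒≡ {S = true ∷ S}  {false ∷ X} S⊆X _   with () ← S⊆X here
⊆∧∣∣≤⇒≡ {S = true ∷ S}  {true ∷ X}  S⊆X X≤S = cong (true ∷_) (⊆∧∣∣≤⇒≡ (drop-∷-⊆ S⊆X) (s≤s⁻¹ X≤S))

suc∣p-x∣≡∣p∣ : ∀ {N} {X : Subset N} {i} → i ∈ X → suc ∣ X - i ∣ ≡ ∣ X ∣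
suc∣p-x∣≡∣p∣ {X = true ∷ X}  here        = cong (suc ∘ ∣_∣) (p─⊥≡p X)
suc∣p-x∣≡∣p∣ {X = false ∷ X} (there i∈X) = suc∣p-x∣≡∣p∣ i∈X
suc∣p-x∣≡∣p∣ {X = true ∷ X}  (there i∈X) = cong suc (suc∣p-x∣≡∣p∣ i∈X)

x∉p-x : ∀ {N} (X : Subset N) i → i ∉ X - i
x∉p-x (_ ∷ X) zero    ()
x∉p-x (_ ∷ X) (suc i) (there i∈X-i) = x∉p-x X i i∈X-i

⊆-x⇔⊆∧∉ : ∀ {N} {S X : Subset N} {i} → (S ⊆ X - i → S ⊆ X × i ∉ S) × (S ⊆ X × i ∉ S → S ⊆ X - i)
⊆-x⇔⊆∧∉ {X = X} {i} =
  (λ S⊆X-i → ⊆-trans S⊆X-i (p─q⊆p X _) , x∉p-x X i ∘ S⊆X-i) ,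
  (λ (S⊆X , i∉S) k∈S → x∈p∧x≢y⇒x∈p-y (S⊆X k∈S) λ { refl → i∉S k∈S })

∣∩∣≡∑ᶠ : ∀ {N} (S D : Subset N) → ∣ S ∩ D ∣ ≡ ∑ᶠ N (λ i → 𝟙 (does (i ∈? S)) * 𝟙 (does (i ∈? D)))
∣∩∣≡∑ᶠ []          []          = refl
∣∩∣≡∑ᶠ (false ∷ S) (_ ∷ D)     = ∣∩∣≡∑ᶠ S D
∣∩∣≡∑ᶠ (true ∷ S)  (false ∷ D) = ∣∩∣≡∑ᶠ S D
∣∩∣≡∑ᶠ (true ∷ S)  (true ∷ D)  = cong suc (∣∩∣≡∑ᶠ S D)

remove-from-∩ : ∀ {N} (S X : Subset N) → 1 ≤ ∣ S ∩ X ∣ →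
                ∃ λ S′ → S′ ⊆ S × suc ∣ S′ ∣ ≡ ∣ S ∣ ×
                         suc ∣ S′ ∩ X ∣ ≡ ∣ S ∩ X ∣ × ∣ S′ ∩ ∁ X ∣ ≡ ∣ S ∩ ∁ X ∣
remove-from-∩ []          []          ()
remove-from-∩ (false ∷ S) (_ ∷ X)     1≤∣S∩X∣ =
  let S′ , S′⊆S , e₁ , e₂ , e₃ = remove-from-∩ S X 1≤∣S∩X∣ in false ∷ S′ , s⊆s S′⊆S , e₁ , e₂ , e₃
remove-from-∩ (true ∷ S)  (false ∷ X) 1≤∣S∩X∣ =
  let S′ , S′⊆S , e₁ , e₂ , e₃ = remove-from-∩ S X 1≤∣S∩X∣ in
  true ∷ S′ , s⊆s S′⊆S , cong suc e₁ , e₂ , cong suc e₃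
remove-from-∩ (true ∷ S)  (true ∷ X)  _ = false ∷ S , out⊆ ⊆-refl , refl , refl , refl

-- Counting subsets

_≟ₛ_ : ∀ {N} → DecidableEquality (Subset N)
_≟ₛ_ = ≡-dec Bool._≟_

∑ₛ-≟ : ∀ {N} (X : Subset N) → ∑ₛ N (λ S → 𝟙 (does (S ≟ₛ X))) ≡ 1
∑ₛ-≟ []                  = refl
∑ₛ-≟ {suc N} (false ∷ X) = cong₂ _+_ (∑ₛ-≟ X) (∑ₛ-zero N)
∑ₛ-≟ {suc N} (true ∷ X)  = cong₂ _+_ (∑ₛ-zero N) (∑ₛ-≟ X)

∑ₛ-∈ : ∀ {N} {𝒳 : List (Subset N)} → Unique 𝒳 → ∑ₛ N (λ S → 𝟙 (does (any? (S ≟ₛ_) 𝒳))) ≡ length 𝒳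
∑ₛ-∈ {N} []                  = ∑ₛ-zero N
∑ₛ-∈ {N} {X ∷ 𝒳} (X∉𝒳 ∷ 𝒳!) =
  trans (∑ₛ-cong pointwise)
        (trans (∑ₛ-distrib-+ (λ S → 𝟙 (does (S ≟ₛ X))) _) (cong₂ _+_ (∑ₛ-≟ X) (∑ₛ-∈ 𝒳!)))
  where
  pointwise : ∀ S → 𝟙 (does (any? (S ≟ₛ_) (X ∷ 𝒳))) ≡ 𝟙 (does (S ≟ₛ X)) + 𝟙 (does (any? (S ≟ₛ_) 𝒳))
  pointwise S with S ≟ₛ X | any? (S ≟ₛ_) 𝒳
  ... | yes refl | yes S∈𝒳 = contradiction S∈𝒳 (Allₚ.All¬⇒¬Any X∉𝒳)
  ... | yes _    | no _    = refl
  ... | no _     | yes _   = refl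
  ... | no _     | no _    = refl

length≤∑ₛ : ∀ {N} {𝒳 : List (Subset N)} (f : Subset N → ℕ) → Unique 𝒳 →
            (∀ {S} → S L.∈ 𝒳 → 1 ≤ f S) → length 𝒳 ≤ ∑ₛ N f
length≤∑ₛ {N} {𝒳} f 𝒳! 1≤f = subst (_≤ ∑ₛ N f) (∑ₛ-∈ 𝒳!) (∑ₛ-mono-≤ pointwise)
  where
  pointwise : ∀ S → 𝟙 (does (any? (S ≟ₛ_) 𝒳)) ≤ f S
  pointwise S with any? (S ≟ₛ_) 𝒳
  ... | yes S∈𝒳 = 1≤f S∈𝒳
  ... | no _    = z≤n

χ : ∀ {N} {P : Pred (Subset N) 0ℓ} → ℕ → Decidable P → Subset N → ℕ
χ j P? S = 𝟙 (does (P? S)) * 𝟙 (∣ S ∣ ≡ᵇ j)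

count : ∀ {N} {P : Pred (Subset N) 0ℓ} → ℕ → Decidable P → ℕ
count {N} j P? = ∑ₛ N (χ j P?)

module _ {N : ℕ} {P Q : Pred (Subset N) 0ℓ} (P? : Decidable P) (Q? : Decidable Q) where

  count-mono : ∀ j → (∀ {S} → P S → Q S) → count j P? ≤ count j Q?
  count-mono j P⇒Q = ∑ₛ-mono-≤ pointwise
    where
    pointwise : ∀ S → χ j P? S ≤ χ j Q? S
    pointwise S with P? S | Q? S
    ... | yes _ | yes _ = ≤-refl
    ... | yes p | no ¬q = contradiction (P⇒Q p) ¬q
    ... | no _  | _     = z≤n

  count-split : ∀ j → count j P? ≡ count j (P? ∩? Q?) + count j (P? ∩? ∁? Q?)
  count-split j = trans (∑ₛ-cong pointwise) (∑ₛ-distrib-+ (χ j (P? ∩? Q?)) (χ j (P? ∩? ∁? Q?)))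
    where
    pointwise : ∀ S → χ j P? S ≡ χ j (P? ∩? Q?) S + χ j (P? ∩? ∁? Q?) S
    pointwise S with P? S | Q? S
    ... | yes _ | yes _ = sym (+-identityʳ _)
    ... | yes _ | no _  = refl
    ... | no _  | _     = refl

count-cong : ∀ {N} {P Q : Pred (Subset N) 0ℓ} (P? : Decidable P) (Q? : Decidable Q) j →
             (∀ {S} → P S → Q S) → (∀ {S} → Q S → P S) → count j P? ≡ count j Q?
count-cong P? Q? j P⇒Q Q⇒P = ≤-antisym (count-mono P? Q? j P⇒Q) (count-mono Q? P? j Q⇒P)

count-⊆ : ∀ {N} (X : Subset N) j → count j (_⊆? X) ≡ ∣ X ∣ C j
count-⊆ []              zero    = refl
count-⊆ []              (suc j) = refl
count-⊆ {suc N} (false ∷ X) j   = trans (cong₂ _+_ (count-⊆ X j) (∑ₛ-zero N)) (+-identityʳ _)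
count-⊆ {suc N} (true ∷ X)  zero =
  cong₂ _+_ (count-⊆ X zero) (trans (∑ₛ-cong (λ S → *-zeroʳ (𝟙 (does (S ⊆? X))))) (∑ₛ-zero N))
count-⊆ {suc N} (true ∷ X)  (suc j) =
  trans (cong₂ _+_ (count-⊆ X (suc j)) (count-⊆ X j))
        (trans (+-comm (∣ X ∣ C suc j) (∣ X ∣ C j)) (nCk+nC[k+1]≡[n+1]C[k+1] ∣ X ∣ j))

count-all : ∀ N j → count {N} j U? ≡ N C j
count-all N j = begin
  count {N} j U?      ≡⟨ count-cong {N} U? (_⊆? ⊤) j (λ _ → ⊆⊤) _ ⟩
  count {N} j (_⊆? ⊤) ≡⟨ count-⊆ (⊤ {N}) j ⟩
  ∣ ⊤ {N} ∣ C j       ≡⟨ cong (_C j) (∣⊤∣≡n N) ⟩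
  N C j               ∎
  where open ≡-Reasoning

count-⊆-∋ : ∀ {N} {X : Subset N} {i} j → i ∈ X → count j ((_⊆? X) ∩? (i ∈?_)) + ∣ X - i ∣ C j ≡ ∣ X ∣ C j
count-⊆-∋ {X = X} {i} j i∈X = begin
  count j ((_⊆? X) ∩? (i ∈?_)) + ∣ X - i ∣ C j
    ≡⟨ cong (count j ((_⊆? X) ∩? (i ∈?_)) +_) (sym (count-⊆ (X - i) j)) ⟩
  count j ((_⊆? X) ∩? (i ∈?_)) + count j (_⊆? X - i)
    ≡⟨ cong (count j ((_⊆? X) ∩? (i ∈?_)) +_) (count-cong (_⊆? X - i) ((_⊆? X) ∩? ∁? (i ∈?_)) j
                                                 (proj₁ ⊆-x⇔⊆∧∉) (proj₂ ⊆-x⇔⊆∧∉)) ⟩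
  count j ((_⊆? X) ∩? (i ∈?_)) + count j ((_⊆? X) ∩? ∁? (i ∈?_))
    ≡⟨ sym (count-split (_⊆? X) (i ∈?_) j) ⟩
  count j (_⊆? X)
    ≡⟨ count-⊆ X j ⟩
  ∣ X ∣ C j ∎
  where open ≡-Reasoning

count-⊆-∋-by-size : ∀ {N} {X Y : Subset N} {i} j → i ∈ X → i ∈ Y → ∣ X ∣ ≡ ∣ Y ∣ →
                    count j ((_⊆? X) ∩? (i ∈?_)) ≡ count j ((_⊆? Y) ∩? (i ∈?_))
count-⊆-∋-by-size {X = X} {Y} {i} j i∈X i∈Y ∣X∣≡∣Y∣ = +-cancelʳ-≡ _ _ _ (begin
  count j ((_⊆? X) ∩? (i ∈?_)) + ∣ X - i ∣ C j ≡⟨ count-⊆-∋ j i∈X ⟩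
  ∣ X ∣ C j                                    ≡⟨ cong (_C j) ∣X∣≡∣Y∣ ⟩
  ∣ Y ∣ C j                                    ≡⟨ sym (count-⊆-∋ j i∈Y) ⟩
  count j ((_⊆? Y) ∩? (i ∈?_)) + ∣ Y - i ∣ C j ≡⟨ cong (λ n → _ + n C j) ∣Y-i∣≡∣X-i∣ ⟩
  count j ((_⊆? Y) ∩? (i ∈?_)) + ∣ X - i ∣ C j ∎)
  where
  open ≡-Reasoning
  ∣Y-i∣≡∣X-i∣ : ∣ Y - i ∣ ≡ ∣ X - i ∣
  ∣Y-i∣≡∣X-i∣ = suc-injective (trans (suc∣p-x∣≡∣p∣ i∈Y) (trans (sym ∣X∣≡∣Y∣) (sym (suc∣p-x∣≡∣p∣ i∈X))))

1≤C : ∀ {n r} → r ≤ n → 1 ≤ n C r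
1≤C {n}     {zero}  _         = ≤-refl
1≤C {suc n} {suc r} (s≤s r≤n) =
  subst (1 ≤_) (nCk+nC[k+1]≡[n+1]C[k+1] n r) (≤-trans (1≤C r≤n) (m≤m+n _ _))

2≤C : ∀ {n r} → 1 ≤ r → r < n → 2 ≤ n C r
2≤C {suc n} {suc r} _ (s≤s r<n) =
  subst (2 ≤_) (nCk+nC[k+1]≡[n+1]C[k+1] n r) (+-mono-≤ (1≤C (<⇒≤ r<n)) (1≤C r<n))

∑ₛ-by-size : ∀ {N} B (f : Subset N → ℕ) (w : ℕ → ℕ) → N < B →
             ∑ₛ N (λ S → f S * w ∣ S ∣) ≡ ∑< B (λ j → w j * ∑ₛ N (λ S → f S * 𝟙 (∣ S ∣ ≡ᵇ j)))
∑ₛ-by-size {N} B f w N<B = begin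
  ∑ₛ N (λ S → f S * w ∣ S ∣)
    ≡⟨ ∑ₛ-cong (λ S → sym (∑<-δ B (f S * w ∣ S ∣) (≤-<-trans (∣p∣≤n S) N<B))) ⟩
  ∑ₛ N (λ S → ∑< B (λ j → 𝟙 (j ≡ᵇ ∣ S ∣) * (f S * w ∣ S ∣)))
    ≡⟨ ∑ₛ-cong (λ S → ∑<-cong B (λ j → δ-swap j ∣ S ∣ (f S))) ⟩
  ∑ₛ N (λ S → ∑< B (λ j → w j * (f S * 𝟙 (∣ S ∣ ≡ᵇ j))))
    ≡⟨ ∑ₛ-∑<-comm B (λ j S → w j * (f S * 𝟙 (∣ S ∣ ≡ᵇ j))) ⟩
  ∑< B (λ j → ∑ₛ N (λ S → w j * (f S * 𝟙 (∣ S ∣ ≡ᵇ j))))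
    ≡⟨ ∑<-cong B (λ j → ∑ₛ-distribˡ-* (w j) (λ S → f S * 𝟙 (∣ S ∣ ≡ᵇ j))) ⟩
  ∑< B (λ j → w j * ∑ₛ N (λ S → f S * 𝟙 (∣ S ∣ ≡ᵇ j))) ∎
  where
  open ≡-Reasoning
  δ-swap : ∀ j s x → 𝟙 (j ≡ᵇ s) * (x * w s) ≡ w j * (x * 𝟙 (s ≡ᵇ j))
  δ-swap j s x rewrite ≡ᵇ-comm s j with j ≡ᵇ s in eq
  ... | false = sym (trans (cong (w j *_) (*-zeroʳ x)) (*-zeroʳ (w j)))
  ... | true with refl ← ≡ᵇ≡true⇒≡ {j} {s} eq =
    trans (+-identityʳ _) (trans (*-comm x (w j)) (cong (w j *_) (sym (*-identityʳ x))))

-- Double counting incidences with a fixed set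

∑ₛ-∣∩∣ : ∀ {N} (D : Subset N) (f : Subset N → ℕ) →
         ∑ₛ N (λ S → f S * ∣ S ∩ D ∣) ≡
         ∑ᶠ N (λ i → 𝟙 (does (i ∈? D)) * ∑ₛ N (λ S → f S * 𝟙 (does (i ∈? S))))
∑ₛ-∣∩∣ {N} D f = begin
  ∑ₛ N (λ S → f S * ∣ S ∩ D ∣)
    ≡⟨ ∑ₛ-cong (λ S → trans (cong (f S *_) (∣∩∣≡∑ᶠ S D)) (sym (∑ᶠ-distribˡ-* (f S) (incidence S)))) ⟩
  ∑ₛ N (λ S → ∑ᶠ N (λ i → f S * incidence S i))
    ≡⟨ ∑ₛ-∑ᶠ-comm (λ i S → f S * incidence S i) ⟩
  ∑ᶠ N (λ i → ∑ₛ N (λ S → f S * incidence S i))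
    ≡⟨ ∑ᶠ-cong (λ i → trans (∑ₛ-cong (rearrange i)) (∑ₛ-distribˡ-* (𝟙∈ i D) (λ S → f S * 𝟙∈ i S))) ⟩
  ∑ᶠ N (λ i → 𝟙 (does (i ∈? D)) * ∑ₛ N (λ S → f S * 𝟙 (does (i ∈? S)))) ∎
  where
  open ≡-Reasoning
  𝟙∈ : Fin N → Subset N → ℕ
  𝟙∈ i S = 𝟙 (does (i ∈? S))
  incidence : Subset N → Fin N → ℕ
  incidence S i = 𝟙∈ i S * 𝟙∈ i D
  rearrange : ∀ i S → f S * incidence S i ≡ 𝟙∈ i D * (f S * 𝟙∈ i S)
  rearrange i S = trans (cong (f S *_) (*-comm (𝟙∈ i S) (𝟙∈ i D))) (*-x∙yz≈y∙xz (f S) (𝟙∈ i D) (𝟙∈ i S))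

module Incidences {N : ℕ} (D : Subset N) (j : ℕ) where

  incidences : ∀ {P : Pred (Subset N) 0ℓ} → Decidable P → ℕ
  incidences P? = ∑ₛ N (λ S → χ j P? S * ∣ S ∩ D ∣)

  incidences-by-point : ∀ {P : Pred (Subset N) 0ℓ} (P? : Decidable P) →
                        incidences P? ≡ ∑ᶠ N (λ i → 𝟙 (does (i ∈? D)) * count j (P? ∩? (i ∈?_)))
  incidences-by-point P? =
    trans (∑ₛ-∣∩∣ D (χ j P?)) (∑ᶠ-cong (λ i → cong (𝟙 (does (i ∈? D)) *_) (∑ₛ-cong (pointwise i))))
    where
    pointwise : ∀ i S → χ j P? S * 𝟙 (does (i ∈? S)) ≡ χ j (P? ∩? (i ∈?_)) S
    pointwise i S with P? S | i ∈? S
    ... | yes _ | yes _ = *-identityʳ (1 * 𝟙 (∣ S ∣ ≡ᵇ j))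
    ... | yes _ | no _  = *-zeroʳ (1 * 𝟙 (∣ S ∣ ≡ᵇ j))
    ... | no _  | _     = refl

  incidences-⊆ : incidences (_⊆? D) ≡ j * count j (_⊆? D)
  incidences-⊆ = trans (∑ₛ-cong pointwise) (∑ₛ-distribˡ-* j (χ j (_⊆? D)))
    where
    pointwise : ∀ S → χ j (_⊆? D) S * ∣ S ∩ D ∣ ≡ j * χ j (_⊆? D) S
    pointwise S with S ⊆? D | ∣ S ∣ ≡ᵇ j in eq
    ... | yes S⊆D | true  = trans (*-identityˡ _)
      (trans (⊆⇒∣∩∣≡∣∣ S⊆D) (trans (≡ᵇ≡true⇒≡ eq) (sym (*-identityʳ j))))
    ... | yes _   | false = sym (*-zeroʳ j)
    ... | no _    | _     = sym (*-zeroʳ j)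

  module _ {P : Pred (Subset N) 0ℓ} (P? : Decidable P) where

    private
      pointwise : ∀ S → χ j P? S * ∣ S ∩ D ∣ ≤ j * χ j P? S
      pointwise S with P? S | ∣ S ∣ ≡ᵇ j in eq
      ... | yes _ | true  = begin
        1 * ∣ S ∩ D ∣  ≡⟨ *-identityˡ _ ⟩
        ∣ S ∩ D ∣      ≤⟨ ∣p∩q∣≤∣p∣ S D ⟩
        ∣ S ∣          ≡⟨ ≡ᵇ≡true⇒≡ eq ⟩
        j              ≡⟨ sym (*-identityʳ j) ⟩
        j * 1          ∎
        where open ≤-Reasoning
      ... | yes _ | false = z≤n
      ... | no _  | _     = z≤n

    incidences-≤ : incidences P? ≤ j * count j P?
    incidences-≤ = ≤-trans (∑ₛ-mono-≤ pointwise) (≤-reflexive (∑ₛ-distribˡ-* j (χ j P?)))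

    incidences-< : ∀ {S₀} → P S₀ → ∣ S₀ ∣ ≡ j → ∣ S₀ ∩ D ∣ < j → incidences P? < j * count j P?
    incidences-< {S₀} p ∣S₀∣≡j ∣S₀∩D∣<j =
      <-≤-trans (∑ₛ-mono-< pointwise S₀ strict) (≤-reflexive (∑ₛ-distribˡ-* j (χ j P?)))
      where
      χ≡1 : χ j P? S₀ ≡ 1
      χ≡1 with P? S₀
      ... | yes _ = trans (*-identityˡ _) (cong 𝟙 (trans (cong (_≡ᵇ j) ∣S₀∣≡j) (≡ᵇ-refl j)))
      ... | no ¬p = contradiction p ¬p
      strict : χ j P? S₀ * ∣ S₀ ∩ D ∣ < j * χ j P? S₀
      strict rewrite χ≡1 = subst₂ _<_ (sym (*-identityˡ _)) (sym (*-identityʳ j)) ∣S₀∩D∣<j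

    Dominates : Set
    Dominates = ∀ i → i ∈ D → count j ((_⊆? D) ∩? (i ∈?_)) ≤ count j (P? ∩? (i ∈?_))

    private
      j*count-⊆≤incidences : Dominates → j * count j (_⊆? D) ≤ incidences P?
      j*count-⊆≤incidences dominates = begin
        j * count j (_⊆? D)                                          ≡⟨ sym incidences-⊆ ⟩
        incidences (_⊆? D)                                           ≡⟨ incidences-by-point (_⊆? D) ⟩
        ∑ᶠ N (λ i → 𝟙 (does (i ∈? D)) * count j ((_⊆? D) ∩? (i ∈?_))) ≤⟨ ∑ᶠ-mono-≤ pointwise′ ⟩
        ∑ᶠ N (λ i → 𝟙 (does (i ∈? D)) * count j (P? ∩? (i ∈?_)))      ≡⟨ sym (incidences-by-point P?) ⟩
        incidences P?                                                ∎
        where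
        open ≤-Reasoning
        pointwise′ : ∀ i → 𝟙 (does (i ∈? D)) * count j ((_⊆? D) ∩? (i ∈?_))
                         ≤ 𝟙 (does (i ∈? D)) * count j (P? ∩? (i ∈?_))
        pointwise′ i with i ∈? D
        ... | yes i∈D = *-monoʳ-≤ 1 (dominates i i∈D)
        ... | no _    = z≤n

    double-count-≤ : .{{NonZero j}} → Dominates → count j (_⊆? D) ≤ count j P?
    double-count-≤ dominates = *-cancelˡ-≤ j (≤-trans (j*count-⊆≤incidences dominates) incidences-≤)

    double-count-< : .{{NonZero j}} → Dominates → ∀ {S₀} → P S₀ → ∣ S₀ ∣ ≡ j → ∣ S₀ ∩ D ∣ < j →
                     count j (_⊆? D) < count j P?
    double-count-< dominates p ∣S₀∣≡j ∣S₀∩D∣<j =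
      *-cancelˡ-< j _ _ (≤-<-trans (j*count-⊆≤incidences dominates) (incidences-< p ∣S₀∣≡j ∣S₀∩D∣<j))

-- The sets below a covering uniform family

Below : ∀ {N} → List (Subset N) → Pred (Subset N) 0ℓ
Below 𝒞 S = Any (S ⊆_) 𝒞

below? : ∀ {N} (𝒞 : List (Subset N)) → Decidable (Below 𝒞)
below? 𝒞 S = any? (S ⊆?_) 𝒞

module Shadow {ℓ : ℕ} (𝒞 : List (Subset (2 * ℓ)))
              (uniform : ∀ {C} → C L.∈ 𝒞 → ∣ C ∣ ≡ ℓ)
              (covers : ∀ i → ∃ λ C → C L.∈ 𝒞 × i ∈ C)
              {C₁ : Subset (2 * ℓ)} (C₁∈𝒞 : C₁ L.∈ 𝒞) where

  D : Subset (2 * ℓ)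
  D = ∁ C₁

  ∣D∣≡ℓ : ∣ D ∣ ≡ ℓ
  ∣D∣≡ℓ = ∣∁∣≡half C₁ (uniform C₁∈𝒞)

  New : Pred (Subset (2 * ℓ)) 0ℓ
  New S = Below 𝒞 S × S ⊈ C₁

  new? : Decidable New
  new? = below? 𝒞 ∩? ∁? (_⊆? C₁)

  count-below : ∀ j → count j (below? 𝒞) ≡ ℓ C j + count j new?
  count-below j = begin
    count j (below? 𝒞)                           ≡⟨ count-split (below? 𝒞) (_⊆? C₁) j ⟩
    count j (below? 𝒞 ∩? (_⊆? C₁)) + count j new? ≡⟨ cong (_+ count j new?) below∧⊆C₁≡⊆C₁ ⟩
    count j (_⊆? C₁) + count j new?              ≡⟨ cong (_+ count j new?) (count-⊆ C₁ j) ⟩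
    ∣ C₁ ∣ C j + count j new?                    ≡⟨ cong (λ n → n C j + count j new?) (uniform C₁∈𝒞) ⟩
    ℓ C j + count j new?                         ∎
    where
    open ≡-Reasoning
    below∧⊆C₁≡⊆C₁ : count j (below? 𝒞 ∩? (_⊆? C₁)) ≡ count j (_⊆? C₁)
    below∧⊆C₁≡⊆C₁ = count-cong (below? 𝒞 ∩? (_⊆? C₁)) (_⊆? C₁) j proj₂
                               (λ S⊆C₁ → lose {P = _ ⊆_} C₁∈𝒞 S⊆C₁ , S⊆C₁)

  -- A j-set through i ∈ D inside a member X ∋ i is new since i ∉ C₁, and there are as many of them
  -- as j-subsets of D through i, because |X| = |D|.
  new-dominates : ∀ j → Incidences.Dominates D j new?
  new-dominates j i i∈D with covers i
  ... | X , X∈𝒞 , i∈X = begin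
    count j ((_⊆? D) ∩? (i ∈?_)) ≡⟨ count-⊆-∋-by-size j i∈D i∈X (trans ∣D∣≡ℓ (sym (uniform X∈𝒞))) ⟩
    count j ((_⊆? X) ∩? (i ∈?_)) ≤⟨ count-mono ((_⊆? X) ∩? (i ∈?_)) (new? ∩? (i ∈?_)) j new-through-i ⟩
    count j (new? ∩? (i ∈?_))    ∎
    where
    open ≤-Reasoning
    new-through-i : ∀ {S} → S ⊆ X × i ∈ S → New S × i ∈ S
    new-through-i (S⊆X , i∈S) = (lose X∈𝒞 S⊆X , λ S⊆C₁ → x∈∁p⇒x∉p i∈D (S⊆C₁ i∈S)) , i∈S

  count-D≡ : ∀ j → count j (_⊆? D) ≡ ℓ C j
  count-D≡ j = trans (count-⊆ D j) (cong (_C j) ∣D∣≡ℓ)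

  shadow-≥ : ∀ j → .{{NonZero j}} → 2 * (ℓ C j) ≤ count j (below? 𝒞)
  shadow-≥ j = begin
    2 * (ℓ C j)           ≡⟨ cong (ℓ C j +_) (+-identityʳ (ℓ C j)) ⟩
    ℓ C j + ℓ C j         ≤⟨ +-monoʳ-≤ (ℓ C j) (subst (_≤ count j new?) (count-D≡ j) new≥) ⟩
    ℓ C j + count j new?  ≡⟨ sym (count-below j) ⟩
    count j (below? 𝒞)    ∎
    where
    open ≤-Reasoning
    new≥ : count j (_⊆? D) ≤ count j new?
    new≥ = Incidences.double-count-≤ D j new? (new-dominates j)

  shadow-> : ∀ j → .{{NonZero j}} → ∀ {S₀} → New S₀ → ∣ S₀ ∣ ≡ j → ∣ S₀ ∩ D ∣ < j →
             2 * (ℓ C j) < count j (below? 𝒞)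
  shadow-> j new ∣S₀∣≡j ∣S₀∩D∣<j = begin-strict
    2 * (ℓ C j)           ≡⟨ cong (ℓ C j +_) (+-identityʳ (ℓ C j)) ⟩
    ℓ C j + ℓ C j         <⟨ +-monoʳ-< (ℓ C j) (subst (_< count j new?) (count-D≡ j) new>) ⟩
    ℓ C j + count j new?  ≡⟨ sym (count-below j) ⟩
    count j (below? 𝒞)    ∎
    where
    open ≤-Reasoning
    new> : count j (_⊆? D) < count j new?
    new> = Incidences.double-count-< D j new? (new-dominates j) new ∣S₀∣≡j ∣S₀∩D∣<j

  private
    ∁D≡C₁ : ∁ D ≡ C₁
    ∁D≡C₁ = ∁-involutive C₁

    ∣E∩C₁∣+∣E∩D∣ : ∀ {E} → E L.∈ 𝒞 → ∣ E ∩ C₁ ∣ + ∣ E ∩ D ∣ ≡ ℓ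
    ∣E∩C₁∣+∣E∩D∣ {E} E∈𝒞 = trans (∣∩∣+∣∩∁∣ E C₁) (uniform E∈𝒞)

    meets-D : ∀ {E} → E L.∈ 𝒞 → E ≢ C₁ → 1 ≤ ∣ E ∩ D ∣
    meets-D E∈𝒞 E≢C₁ = n≢0⇒n>0 λ ∣E∩D∣≡0 →
      E≢C₁ (⊆∧∣∣≤⇒≡ (∣∩∁∣≡0⇒⊆ ∣E∩D∣≡0) (≤-reflexive (trans (uniform C₁∈𝒞) (sym (uniform E∈𝒞)))))

    meets-C₁ : ∀ {E} → E L.∈ 𝒞 → E ≢ D → 1 ≤ ∣ E ∩ C₁ ∣
    meets-C₁ {E} E∈𝒞 E≢D = n≢0⇒n>0 λ ∣E∩C₁∣≡0 →
      E≢D (⊆∧∣∣≤⇒≡ (∣∩∁∣≡0⇒⊆ (subst (λ Y → ∣ E ∩ Y ∣ ≡ 0) (sym ∁D≡C₁) ∣E∩C₁∣≡0))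
                   (≤-reflexive (trans ∣D∣≡ℓ (sym (uniform E∈𝒞)))))

    meets-both : ∀ {S E} → E L.∈ 𝒞 → S ⊆ E → 1 ≤ ∣ S ∩ C₁ ∣ → 1 ≤ ∣ S ∩ D ∣ →
                 New S × ∣ S ∩ D ∣ < ∣ S ∣
    meets-both {S} E∈𝒞 S⊆E 1≤∣S∩C₁∣ 1≤∣S∩D∣ =
      (lose E∈𝒞 S⊆E , λ S⊆C₁ → <⇒≢ 1≤∣S∩D∣ (sym (⊆⇒∣∩∁∣≡0 S⊆C₁))) ,
      subst (∣ S ∩ D ∣ <_) (trans (+-comm ∣ S ∩ D ∣ ∣ S ∩ C₁ ∣) (∣∩∣+∣∩∁∣ S C₁))
                           (m<m+n ∣ S ∩ D ∣ 1≤∣S∩C₁∣)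

  -- Since |E| = ℓ ≥ 3, one of E ∩ C₁ and E ∩ D has two points; drop one of them.
  witness : 3 ≤ ℓ → ∀ {E} → E L.∈ 𝒞 → E ≢ C₁ → E ≢ D →
            ∃ λ S₀ → (New S₀ × ∣ S₀ ∩ D ∣ < ∣ S₀ ∣) × suc ∣ S₀ ∣ ≡ ℓ
  witness 3≤ℓ {E} E∈𝒞 E≢C₁ E≢D with 2 ≤? ∣ E ∩ C₁ ∣
  ... | yes 2≤∣E∩C₁∣ =
    let S₀ , S₀⊆E , ∣S₀∣ , ∣S₀∩C₁∣ , ∣S₀∩D∣ = remove-from-∩ E C₁ (meets-C₁ E∈𝒞 E≢D)
    in S₀ , meets-both E∈𝒞 S₀⊆E (s≤s⁻¹ (subst (2 ≤_) (sym ∣S₀∩C₁∣) 2≤∣E∩C₁∣))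
                                 (subst (1 ≤_) (sym ∣S₀∩D∣) (meets-D E∈𝒞 E≢C₁))
          , trans ∣S₀∣ (uniform E∈𝒞)
  ... | no 2≰∣E∩C₁∣ =
    let S₀ , S₀⊆E , ∣S₀∣ , ∣S₀∩D∣ , ∣S₀∩∁D∣ = remove-from-∩ E D (meets-D E∈𝒞 E≢C₁)
        ∣S₀∩C₁∣ = subst (λ Y → ∣ S₀ ∩ Y ∣ ≡ ∣ E ∩ Y ∣) ∁D≡C₁ ∣S₀∩∁D∣
        2≤∣E∩D∣ = +-cancelˡ-≤ 1 2 _ (begin
          3                          ≤⟨ 3≤ℓ ⟩
          ℓ                          ≡⟨ sym (∣E∩C₁∣+∣E∩D∣ E∈𝒞) ⟩
          ∣ E ∩ C₁ ∣ + ∣ E ∩ D ∣     ≤⟨ +-monoˡ-≤ _ (s≤s⁻¹ (≰⇒> 2≰∣E∩C₁∣)) ⟩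
          1 + ∣ E ∩ D ∣              ∎)
    in S₀ , meets-both E∈𝒞 S₀⊆E (subst (1 ≤_) (sym ∣S₀∩C₁∣) (meets-C₁ E∈𝒞 E≢D))
                                 (s≤s⁻¹ (subst (2 ≤_) (sym ∣S₀∩D∣) 2≤∣E∩D∣))
          , trans ∣S₀∣ (uniform E∈𝒞)
    where open ≤-Reasoning

-- The weighted inequality

g+2w≤w*c+2 : ∀ {w g c} → 1 ≤ w → 2 ≤ g → g ≤ c → g + 2 * w ≤ w * c + 2
g+2w≤w*c+2 {suc w} {suc (suc g)} {c} (s≤s z≤n) (s≤s (s≤s z≤n)) g≤c = begin
  suc (suc g) + 2 * suc w           ≤⟨ m≤m+n _ (w * g) ⟩
  suc (suc g) + 2 * suc w + w * g   ≡⟨ expand w g ⟩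
  suc w * suc (suc g) + 2           ≤⟨ +-monoˡ-≤ 2 (*-monoʳ-≤ (suc w) g≤c) ⟩
  suc w * c + 2                     ∎
  where
  open ≤-Reasoning
  expand : ∀ w g → suc (suc g) + 2 * suc w + w * g ≡ suc w * suc (suc g) + 2
  expand = solve-∀

g+2w<w*c+2 : ∀ {w g c} → 2 ≤ w → 3 ≤ g → g ≤ c → g + 2 * w < w * c + 2
g+2w<w*c+2 {suc w@(suc _)} {suc (suc g@(suc _))} {c} (s≤s (s≤s z≤n)) (s≤s (s≤s (s≤s z≤n))) g≤c =
  begin-strict
  suc (suc g) + 2 * suc w           <⟨ m<m+n _ {w * g} (s≤s z≤n) ⟩
  suc (suc g) + 2 * suc w + w * g   ≡⟨ expand w g ⟩
  suc w * suc (suc g) + 2           ≤⟨ +-monoˡ-≤ 2 (*-monoʳ-≤ (suc w) g≤c) ⟩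
  suc w * c + 2                     ∎
  where
  open ≤-Reasoning
  expand : ∀ w g → suc (suc g) + 2 * suc w + w * g ≡ suc w * suc (suc g) + 2
  expand = solve-∀

distinct⇒2≤length : ∀ {A : Set} {x y : A} {xs} → x L.∈ xs → y L.∈ xs → x ≢ y → 2 ≤ length xs
distinct⇒2≤length {xs = _ ∷ []}    (Any.here refl) (Any.here refl) x≢y = contradiction refl x≢y
distinct⇒2≤length {xs = _ ∷ _ ∷ _} _               _               _   = s≤s (s≤s z≤n)

avoid-two : ∀ {A : Set} → DecidableEquality A → ∀ {xs : List A} → Unique xs → 3 ≤ length xs →
            ∀ a b → ∃ λ x → x L.∈ xs × x ≢ a × x ≢ b
avoid-two _≟_ {_ ∷ []}     _ (s≤s ())
avoid-two _≟_ {_ ∷ _ ∷ []} _ (s≤s (s≤s ()))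
avoid-two _≟_ {x ∷ y ∷ z ∷ _} ((x≢y ∷ x≢z ∷ _) ∷ (y≢z ∷ _) ∷ _) _ a b with x ≟ a | x ≟ b
... | no x≢a   | no x≢b   = x , Any.here refl , x≢a , x≢b
... | yes refl | _        = second-or-third (y ≟ b) (x≢y ∘ sym) (x≢z ∘ sym) (y≢z ∘ sym)
  where
  second-or-third : Dec (y ≡ b) → y ≢ a → z ≢ a → z ≢ y → ∃ λ x → x L.∈ _ × x ≢ a × x ≢ b
  second-or-third (no y≢b)   y≢a _   _   = y , Any.there (Any.here refl) , y≢a , y≢b
  second-or-third (yes refl) _   z≢a z≢y = z , Any.there (Any.there (Any.here refl)) , z≢a , z≢y
... | no _     | yes refl = second-or-third (y ≟ a) (x≢y ∘ sym) (x≢z ∘ sym) (y≢z ∘ sym)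
  where
  second-or-third : Dec (y ≡ a) → y ≢ b → z ≢ b → z ≢ y → ∃ λ x → x L.∈ _ × x ≢ a × x ≢ b
  second-or-third (no y≢a)   y≢b _   _   = y , Any.there (Any.here refl) , y≢a , y≢b
  second-or-third (yes refl) _   z≢b z≢y = z , Any.there (Any.there (Any.here refl)) , z≢y , z≢b

Unique-map⁺ : ∀ {A B : Set} (f : A → B) {xs : List A} → Unique xs →
              (∀ {x y} → x L.∈ xs → y L.∈ xs → f x ≡ f y → x ≡ y) → Unique (map f xs)
Unique-map⁺ f []           _   = []
Unique-map⁺ f (x∉xs ∷ xs!) inj =
  Allₚ.map⁺ (All.tabulate λ y∈xs fx≡fy →
               All.lookup x∉xs y∈xs (inj (Any.here refl) (Any.there y∈xs) fx≡fy))
  ∷ Unique-map⁺ f xs! (λ x∈xs y∈xs → inj (Any.there x∈xs) (Any.there y∈xs))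

module Weighted {ℓ : ℕ} .{{_ : NonZero ℓ}} (𝒞 : List (Subset (2 * ℓ))) (𝒞! : Unique 𝒞)
                (uniform : ∀ {C} → C L.∈ 𝒞 → ∣ C ∣ ≡ ℓ)
                (covers : ∀ i → ∃ λ C → C L.∈ 𝒞 × i ∈ C)
                (w : ℕ → ℕ) (1≤wℓ : 1 ≤ w ℓ) where

  g : ℕ
  g = length 𝒞

  i₀ : Fin (2 * ℓ)
  i₀ = fromℕ< (*-monoʳ-< 2 (>-nonZero⁻¹ ℓ))

  C₁ : Subset (2 * ℓ)
  C₁ = proj₁ (covers i₀)

  C₁∈𝒞 : C₁ L.∈ 𝒞
  C₁∈𝒞 = proj₁ (proj₂ (covers i₀))

  open Shadow 𝒞 uniform covers C₁∈𝒞

  ℓ≢0 : ℓ ≢ 0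
  ℓ≢0 = ≢-nonZero⁻¹ ℓ

  2≤g : 2 ≤ g
  2≤g with nonempty? D
  ... | yes (i , i∈D) = let X , X∈𝒞 , i∈X = covers i in
    distinct⇒2≤length C₁∈𝒞 X∈𝒞 (λ C₁≡X → x∈∁p⇒x∉p i∈D (subst (i ∈_) (sym C₁≡X) i∈X))
  ... | no D-empty =
    contradiction (trans (sym ∣D∣≡ℓ) (trans (cong ∣_∣ (Empty-unique D-empty)) (∣⊥∣≡0 (2 * ℓ)))) ℓ≢0

  g≤count-ℓ : g ≤ count ℓ (below? 𝒞)
  g≤count-ℓ = length≤∑ₛ (χ ℓ (below? 𝒞)) 𝒞! member
    where
    member : ∀ {C} → C L.∈ 𝒞 → 1 ≤ χ ℓ (below? 𝒞) C
    member {C} C∈𝒞 with below? 𝒞 C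
    ... | yes _ rewrite uniform C∈𝒞 | ≡ᵇ-refl ℓ = ≤-refl
    ... | no ¬below = contradiction (lose {P = C ⊆_} C∈𝒞 ⊆-refl) ¬below

  1≤count-0 : 1 ≤ count 0 (below? 𝒞)
  1≤count-0 = ≤-trans χ⊥ (term≤∑ₛ (χ 0 (below? 𝒞)) ⊥)
    where
    χ⊥ : 1 ≤ χ 0 (below? 𝒞) ⊥
    χ⊥ with below? 𝒞 ⊥
    ... | yes _ rewrite ∣⊥∣≡0 (2 * ℓ) = ≤-refl
    ... | no ¬below = contradiction (lose {P = ⊥ ⊆_} C₁∈𝒞 ⊥⊆) ¬below

  B : ℕ
  B = suc (2 * ℓ)

  ℓ<B : ℓ < B
  ℓ<B = s≤s (m≤m+n ℓ (ℓ + 0))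

  -- The contributions of the j-sets to the two sides of weighted-≤ below.
  L R : ℕ → ℕ
  L j = 𝟙 (j ≡ᵇ ℓ) * g + 2 * (w j * (ℓ C j))
  R j = w j * count j (below? 𝒞) + 𝟙 (j ≡ᵇ 0) * w 0 + 𝟙 (j ≡ᵇ ℓ) * 2

  L-other : ∀ {j} → j ≢ ℓ → L j ≡ 2 * (w j * (ℓ C j))
  L-other {j} j≢ℓ = cong (_+ 2 * (w j * (ℓ C j))) (δ-≢ g j≢ℓ)

  R-other : ∀ {j} → j ≢ 0 → j ≢ ℓ → R j ≡ w j * count j (below? 𝒞)
  R-other {j} j≢0 j≢ℓ =
    trans (cong₂ (λ a b → w j * count j (below? 𝒞) + a + b) (δ-≢ (w 0) j≢0) (δ-≢ 2 j≢ℓ))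
          (trans (+-identityʳ _) (+-identityʳ _))

  L-ℓ : L ℓ ≡ g + 2 * w ℓ
  L-ℓ = cong₂ (λ a b → a + 2 * b) (δ-≡ ℓ g) (trans (cong (w ℓ *_) (nCn≡1 ℓ)) (*-identityʳ (w ℓ)))

  R-ℓ : R ℓ ≡ w ℓ * count ℓ (below? 𝒞) + 2
  R-ℓ = trans (cong₂ (λ a b → w ℓ * count ℓ (below? 𝒞) + a + b) (δ-≢ (w 0) ℓ≢0) (δ-≡ ℓ 2))
              (cong (_+ 2) (+-identityʳ _))

  level-0 : L 0 ≤ R 0
  level-0 = begin
    L 0                              ≡⟨ L-other (ℓ≢0 ∘ sym) ⟩
    2 * (w 0 * 1)                    ≡⟨ cong (w 0 * 1 +_) (trans (+-identityʳ _) (*-identityʳ (w 0))) ⟩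
    w 0 * 1 + w 0                    ≤⟨ +-monoˡ-≤ (w 0) (*-monoʳ-≤ (w 0) 1≤count-0) ⟩
    w 0 * count 0 (below? 𝒞) + w 0   ≡⟨ sym R-0 ⟩
    R 0                              ∎
    where
    open ≤-Reasoning
    R-0 : R 0 ≡ w 0 * count 0 (below? 𝒞) + w 0
    R-0 = trans (cong₂ (λ a b → w 0 * count 0 (below? 𝒞) + a + b)
                       (+-identityʳ (w 0)) (δ-≢ 2 (ℓ≢0 ∘ sym)))
                (+-identityʳ _)

  level-ℓ-≤ : L ℓ ≤ R ℓ
  level-ℓ-≤ = subst₂ _≤_ (sym L-ℓ) (sym R-ℓ) (g+2w≤w*c+2 1≤wℓ 2≤g g≤count-ℓ)

  level-ℓ-< : 2 ≤ w ℓ → 3 ≤ g → L ℓ < R ℓ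
  level-ℓ-< 2≤wℓ 3≤g = subst₂ _<_ (sym L-ℓ) (sym R-ℓ) (g+2w<w*c+2 2≤wℓ 3≤g g≤count-ℓ)

  level-other-≤ : ∀ j → .{{NonZero j}} → j ≢ ℓ → L j ≤ R j
  level-other-≤ j j≢ℓ = begin
    L j                          ≡⟨ L-other j≢ℓ ⟩
    2 * (w j * (ℓ C j))          ≡⟨ *-x∙yz≈y∙xz 2 (w j) (ℓ C j) ⟩
    w j * (2 * (ℓ C j))          ≤⟨ *-monoʳ-≤ (w j) (shadow-≥ j) ⟩
    w j * count j (below? 𝒞)     ≡⟨ sym (R-other (≢-nonZero⁻¹ j) j≢ℓ) ⟩
    R j                          ∎
    where open ≤-Reasoning

  level-other-< : ∀ j → .{{NonZero j}} → j ≢ ℓ → 1 ≤ w j → 2 * (ℓ C j) < count j (below? 𝒞) → L j < R j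
  level-other-< j j≢ℓ 1≤wj shadow<count = begin-strict
    L j                          ≡⟨ L-other j≢ℓ ⟩
    2 * (w j * (ℓ C j))          ≡⟨ *-x∙yz≈y∙xz 2 (w j) (ℓ C j) ⟩
    w j * (2 * (ℓ C j))          <⟨ *-monoʳ-< (w j) {{>-nonZero 1≤wj}} shadow<count ⟩
    w j * count j (below? 𝒞)     ≡⟨ sym (R-other (≢-nonZero⁻¹ j) j≢ℓ) ⟩
    R j                          ∎
    where open ≤-Reasoning

  level-≤ : ∀ j → L j ≤ R j
  level-≤ zero      = level-0
  level-≤ j@(suc _) with j ≟ ℓ
  ... | yes refl = level-ℓ-≤
  ... | no j≢ℓ   = level-other-≤ j j≢ℓ

  strict-level : 3 ≤ g → 2 ≤ w ℓ ⊎ (3 ≤ ℓ × 1 ≤ w (pred ℓ)) → ∃ λ j → j < B × L j < R j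
  strict-level 3≤g (inj₁ 2≤wℓ)         = ℓ , ℓ<B , level-ℓ-< 2≤wℓ 3≤g
  strict-level 3≤g (inj₂ (3≤ℓ , 1≤wj)) =
    let E , E∈𝒞 , E≢C₁ , E≢D = avoid-two _≟ₛ_ 𝒞! 3≤g C₁ D
        S₀ , (new , ∣S₀∩D∣<∣S₀∣) , 1+∣S₀∣≡ℓ = witness 3≤ℓ E∈𝒞 E≢C₁ E≢D
        ∣S₀∣≡pred-ℓ = cong pred 1+∣S₀∣≡ℓ
    in pred ℓ , <-trans pred-ℓ<ℓ ℓ<B ,
       level-other-< (pred ℓ) (<⇒≢ pred-ℓ<ℓ) 1≤wj
         (shadow-> (pred ℓ) new ∣S₀∣≡pred-ℓ (subst (∣ S₀ ∩ D ∣ <_) ∣S₀∣≡pred-ℓ ∣S₀∩D∣<∣S₀∣))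
    where
    pred-ℓ<ℓ : pred ℓ < ℓ
    pred-ℓ<ℓ = ≤-reflexive (suc-pred ℓ)
    instance
      pred-ℓ-nonZero : NonZero (pred ℓ)
      pred-ℓ-nonZero =
        >-nonZero (≤-trans (s≤s z≤n) (s≤s⁻¹ (≤-trans 3≤ℓ (≤-reflexive (sym (suc-pred ℓ))))))

  ∑L : ∑< B L ≡ g + 2 * ∑< B (λ j → w j * (ℓ C j))
  ∑L = trans (∑<-distrib-+ B (λ j → 𝟙 (j ≡ᵇ ℓ) * g) (λ j → 2 * (w j * (ℓ C j))))
             (cong₂ _+_ (∑<-δ B g ℓ<B) (∑<-distribˡ-* B 2 (λ j → w j * (ℓ C j))))

  ∑R : ∑< B R ≡ ∑< B (λ j → w j * count j (below? 𝒞)) + w 0 + 2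
  ∑R = begin
    ∑< B R
      ≡⟨ ∑<-distrib-+ B (λ j → w j * count j (below? 𝒞) + 𝟙 (j ≡ᵇ 0) * w 0) (λ j → 𝟙 (j ≡ᵇ ℓ) * 2) ⟩
    ∑< B (λ j → w j * count j (below? 𝒞) + 𝟙 (j ≡ᵇ 0) * w 0) + ∑< B (λ j → 𝟙 (j ≡ᵇ ℓ) * 2)
      ≡⟨ cong₂ _+_ (∑<-distrib-+ B (λ j → w j * count j (below? 𝒞)) (λ j → 𝟙 (j ≡ᵇ 0) * w 0))
                   (∑<-δ B 2 ℓ<B) ⟩
    ∑< B (λ j → w j * count j (below? 𝒞)) + ∑< B (λ j → 𝟙 (j ≡ᵇ 0) * w 0) + 2
      ≡⟨ cong (λ a → ∑< B (λ j → w j * count j (below? 𝒞)) + a + 2) (∑<-δ B (w 0) (s≤s z≤n)) ⟩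
    ∑< B (λ j → w j * count j (below? 𝒞)) + w 0 + 2 ∎
    where open ≡-Reasoning

  ∑ₛ-ℓ : ∑ₛ ℓ (λ S → w ∣ S ∣) ≡ ∑< B (λ j → w j * (ℓ C j))
  ∑ₛ-ℓ = trans (∑ₛ-cong (λ (S : Subset ℓ) → sym (*-identityˡ (w ∣ S ∣))))
               (trans (∑ₛ-by-size B (λ _ → 1) w ℓ<B) (∑<-cong B (λ j → cong (w j *_) (count-all ℓ j))))

  ∑ₛ-below : ∑ₛ (2 * ℓ) (λ S → 𝟙 (does (below? 𝒞 S)) * w ∣ S ∣) ≡ ∑< B (λ j → w j * count j (below? 𝒞))
  ∑ₛ-below = ∑ₛ-by-size B (λ S → 𝟙 (does (below? 𝒞 S))) w ≤-refl

  lhs≡∑L : g + 2 * ∑ₛ ℓ (λ S → w ∣ S ∣) ≡ ∑< B L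
  lhs≡∑L = trans (cong (λ a → g + 2 * a) ∑ₛ-ℓ) (sym ∑L)

  rhs≡∑R : ∑ₛ (2 * ℓ) (λ S → 𝟙 (does (below? 𝒞 S)) * w ∣ S ∣) + w 0 + 2 ≡ ∑< B R
  rhs≡∑R = trans (cong (λ a → a + w 0 + 2) ∑ₛ-below) (sym ∑R)

  weighted-≤ : g + 2 * ∑ₛ ℓ (λ S → w ∣ S ∣) ≤
               ∑ₛ (2 * ℓ) (λ S → 𝟙 (does (below? 𝒞 S)) * w ∣ S ∣) + w 0 + 2
  weighted-≤ = subst₂ _≤_ (sym lhs≡∑L) (sym rhs≡∑R) (∑<-mono-≤ B level-≤)

  weighted-< : 3 ≤ g → 2 ≤ w ℓ ⊎ (3 ≤ ℓ × 1 ≤ w (pred ℓ)) →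
               g + 2 * ∑ₛ ℓ (λ S → w ∣ S ∣) <
               ∑ₛ (2 * ℓ) (λ S → 𝟙 (does (below? 𝒞 S)) * w ∣ S ∣) + w 0 + 2
  weighted-< 3≤g strict-weight =
    let j , j<B , Lj<Rj = strict-level 3≤g strict-weight
    in subst₂ _<_ (sym lhs≡∑L) (sym rhs≡∑R) (∑<-mono-< B level-≤ j<B Lj<Rj)

-- Traces on the first 2ℓ points

extensions : ℕ → ℕ → ℕ → ℕ
extensions m k s = ∑ₛ m (λ R → 𝟙 (s + ∣ R ∣ ≡ᵇ k))

extensions≡C : ∀ m {k s} → s ≤ k → extensions m k s ≡ m C (k ∸ s)
extensions≡C m {k} {s} s≤k =
  trans (∑ₛ-cong (λ (R : Subset m) → trans (cong 𝟙 (shift s ∣ R ∣ s≤k)) (sym (*-identityˡ _))))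
        (count-all m (k ∸ s))
  where
  shift : ∀ s r {k} → s ≤ k → (s + r ≡ᵇ k) ≡ (r ≡ᵇ k ∸ s)
  shift zero    r z≤n       = refl
  shift (suc s) r (s≤s s≤k) = shift s r s≤k

take-++ : ∀ {A : Set} N {m} (S : Vec A N) (R : Vec A m) → take N (S ++ R) ≡ S
take-++ zero    []      R = refl
take-++ (suc N) (x ∷ S) R = cong (x ∷_) (take-++ N S R)

∑ₛ-by-trace : ∀ N {m} k (f : Subset N → ℕ) →
              ∑ₛ (N + m) (λ H → f (take N H) * 𝟙 (∣ H ∣ ≡ᵇ k)) ≡ ∑ₛ N (λ S → f S * extensions m k ∣ S ∣)
∑ₛ-by-trace N {m} k f = trans (∑ₛ-++ N _) (∑ₛ-cong λ S →
  trans (∑ₛ-cong (λ (R : Subset m) → cong₂ (λ T n → f T * 𝟙 (n ≡ᵇ k)) (take-++ N S R) (∣++∣ S R)))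
        (∑ₛ-distribˡ-* (f S) (λ (R : Subset m) → 𝟙 (∣ S ∣ + ∣ R ∣ ≡ᵇ k))))

drop≡⊥ : ∀ N {m} (G : Subset (N + m)) → (∀ i → i ∈ G → toℕ i < N) → drop N G ≡ ⊥
drop≡⊥ zero    G       within = Empty-unique (λ (i , i∈G) → n≮0 (within i i∈G))
drop≡⊥ (suc N) (_ ∷ G) within = drop≡⊥ N G (λ i i∈G → s≤s⁻¹ (within (suc i) (there i∈G)))

∣take∣+∣drop∣ : ∀ N {m} (G : Subset (N + m)) → ∣ take N G ∣ + ∣ drop N G ∣ ≡ ∣ G ∣
∣take∣+∣drop∣ N G = trans (sym (∣++∣ (take N G) (drop N G))) (cong ∣_∣ (take++drop≡id N G))

∈-take⁻ : ∀ N {m} {G : Subset (N + m)} {i} → i ∈ take N G → (i ↑ˡ m) ∈ G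
∈-take⁻ (suc N) {G = _ ∷ _} here        = here
∈-take⁻ (suc N) {G = _ ∷ _} (there i∈G) = there (∈-take⁻ N i∈G)

∩-take : ∀ N {m} {H G : Subset (N + m)} {x} → x ∈ H → x ∈ G → drop N G ≡ ⊥ →
         ∃ λ i → i ∈ take N H × i ∈ take N G
∩-take zero    {x = x} _ x∈G G≡⊥ = contradiction (subst (x ∈_) G≡⊥ x∈G) ∉⊥
∩-take (suc N) {H = _ ∷ _} {_ ∷ _} here        here        _   = zero , here , here
∩-take (suc N) {H = _ ∷ _} {_ ∷ _} (there x∈H) (there x∈G) G≡⊥ =
  let i , i∈H , i∈G = ∩-take N x∈H x∈G G≡⊥ in suc i , there i∈H , there i∈G

module Bound {ℓ m k : ℕ} .{{_ : NonZero ℓ}} (ℓ≤k : ℓ ≤ k) (k<ℓ+m : k < ℓ + m)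
             (𝓕 𝓖 : Family (2 * ℓ + m)) (𝓕-uniform : Uniform k 𝓕) (𝓖-uniform : Uniform ℓ 𝓖)
             (𝓖-within : WithinFirst (2 * ℓ) 𝓖) (𝓖-nontrivial : NonTrivial 𝓖)
             (cross : CrossIntersecting 𝓕 𝓖) where

  N : ℕ
  N = 2 * ℓ

  drop-G≡⊥ : ∀ {G} → G L.∈ members 𝓖 → drop N G ≡ ⊥
  drop-G≡⊥ {G} G∈𝓖 = drop≡⊥ N G (All.lookup 𝓖-within G∈𝓖)

  ∣take-G∣≡ℓ : ∀ {G} → G L.∈ members 𝓖 → ∣ take N G ∣ ≡ ℓ
  ∣take-G∣≡ℓ {G} G∈𝓖 = begin
    ∣ take N G ∣                 ≡⟨ sym (+-identityʳ _) ⟩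
    ∣ take N G ∣ + 0             ≡⟨ cong (∣ take N G ∣ +_) (sym ∣drop-G∣≡0) ⟩
    ∣ take N G ∣ + ∣ drop N G ∣  ≡⟨ ∣take∣+∣drop∣ N G ⟩
    ∣ G ∣                        ≡⟨ All.lookup 𝓖-uniform G∈𝓖 ⟩
    ℓ                            ∎
    where
    open ≡-Reasoning
    ∣drop-G∣≡0 : ∣ drop N G ∣ ≡ 0
    ∣drop-G∣≡0 = trans (cong ∣_∣ (drop-G≡⊥ G∈𝓖)) (∣⊥∣≡0 m)

  φ : Subset (N + m) → Subset N
  φ G = ∁ (take N G)

  𝒞 : List (Subset N)
  𝒞 = map φ (members 𝓖)

  𝒞-uniform : ∀ {C} → C L.∈ 𝒞 → ∣ C ∣ ≡ ℓ
  𝒞-uniform C∈𝒞 with ∈-map⁻ φ C∈𝒞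
  ... | G , G∈𝓖 , refl = ∣∁∣≡half (take N G) (∣take-G∣≡ℓ G∈𝓖)

  𝒞-covers : ∀ i → ∃ λ C → C L.∈ 𝒞 × i ∈ C
  𝒞-covers i with 𝓖-nontrivial (i ↑ˡ m)
  ... | G , G∈𝓖 , i∉G = φ G , ∈-map⁺ φ G∈𝓖 , x∉p⇒x∈∁p (i∉G ∘ ∈-take⁻ N)

  𝒞-unique : Unique 𝒞
  𝒞-unique = Unique-map⁺ φ (unique 𝓖) φ-injective
    where
    φ-injective : ∀ {G G′} → G L.∈ members 𝓖 → G′ L.∈ members 𝓖 → φ G ≡ φ G′ → G ≡ G′
    φ-injective {G} {G′} G∈𝓖 G′∈𝓖 φG≡φG′ = begin
      G                          ≡⟨ sym (take++drop≡id N G) ⟩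
      take N G ++ drop N G       ≡⟨ cong₂ _++_ take-G≡take-G′ drop-G≡drop-G′ ⟩
      take N G′ ++ drop N G′     ≡⟨ take++drop≡id N G′ ⟩
      G′                         ∎
      where
      open ≡-Reasoning
      take-G≡take-G′ : take N G ≡ take N G′
      take-G≡take-G′ = trans (sym (∁-involutive _)) (trans (cong ∁ φG≡φG′) (∁-involutive _))
      drop-G≡drop-G′ : drop N G ≡ drop N G′
      drop-G≡drop-G′ = trans (drop-G≡⊥ G∈𝓖) (sym (drop-G≡⊥ G′∈𝓖))

  w : ℕ → ℕ
  w = extensions m k

  k∸ℓ<m : k ∸ ℓ < m
  k∸ℓ<m = subst (k ∸ ℓ <_) (m+n∸m≡n ℓ m) (∸-monoˡ-< k<ℓ+m ℓ≤k)

  1≤wℓ : 1 ≤ w ℓ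
  1≤wℓ = subst (1 ≤_) (sym (extensions≡C m ℓ≤k)) (1≤C (<⇒≤ k∸ℓ<m))

  open Weighted 𝒞 𝒞-unique 𝒞-uniform 𝒞-covers w 1≤wℓ using (g; 2≤g; weighted-≤; weighted-<)

  trace-not-below : ∀ {H} → H L.∈ members 𝓕 → ¬ Below 𝒞 (take N H)
  trace-not-below {H} H∈𝓕 below with find below
  ... | C , C∈𝒞 , H⊆C with ∈-map⁻ φ C∈𝒞
  ... | G , G∈𝓖 , refl =
    let x , x∈H∩G    = cross H G H∈𝓕 G∈𝓖
        x∈H , x∈G    = x∈p∩q⁻ H G x∈H∩G
        i , i∈H , i∈G = ∩-take N x∈H x∈G (drop-G≡⊥ G∈𝓖)
    in x∈p⇒x∉∁p i∈G (H⊆C i∈H)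

  card-𝓕≤ : card 𝓕 ≤ ∑ₛ N (λ S → 𝟙 (does (∁? (below? 𝒞) S)) * w ∣ S ∣)
  card-𝓕≤ = subst (card 𝓕 ≤_) (∑ₛ-by-trace N k (λ S → 𝟙 (does (∁? (below? 𝒞) S))))
                  (length≤∑ₛ _ (unique 𝓕) member)
    where
    member : ∀ {H} → H L.∈ members 𝓕 → 1 ≤ 𝟙 (does (∁? (below? 𝒞) (take N H))) * 𝟙 (∣ H ∣ ≡ᵇ k)
    member {H} H∈𝓕 with below? 𝒞 (take N H)
    ... | yes below = contradiction below (trace-not-below H∈𝓕)
    ... | no _ rewrite All.lookup 𝓕-uniform H∈𝓕 | ≡ᵇ-refl k = ≤-refl

  binomial-by-trace : ∀ M → (M + m) C k ≡ ∑ₛ M (λ S → w ∣ S ∣)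
  binomial-by-trace M =
    trans (sym (count-all (M + m) k))
          (trans (∑ₛ-by-trace M k (λ _ → 1)) (∑ₛ-cong (λ (S : Subset M) → *-identityˡ (w ∣ S ∣))))

  split-by-below : ∑ₛ N (λ S → w ∣ S ∣) ≡
    ∑ₛ N (λ S → 𝟙 (does (∁? (below? 𝒞) S)) * w ∣ S ∣) + ∑ₛ N (λ S → 𝟙 (does (below? 𝒞 S)) * w ∣ S ∣)
  split-by-below =
    trans (∑ₛ-cong pointwise) (∑ₛ-distrib-+ (λ S → 𝟙 (does (∁? (below? 𝒞) S)) * w ∣ S ∣) _)
    where
    pointwise : ∀ S → w ∣ S ∣ ≡ 𝟙 (does (∁? (below? 𝒞) S)) * w ∣ S ∣ + 𝟙 (does (below? 𝒞 S)) * w ∣ S ∣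
    pointwise S with below? 𝒞 S
    ... | yes _ = sym (+-identityʳ _)
    ... | no _  = sym (trans (+-identityʳ _) (+-identityʳ _))

  private
    A M X : ℕ
    A = ∑ₛ N (λ S → 𝟙 (does (∁? (below? 𝒞) S)) * w ∣ S ∣)
    M = ∑ₛ N (λ S → 𝟙 (does (below? 𝒞 S)) * w ∣ S ∣)
    X = ∑ₛ ℓ (λ S → w ∣ S ∣)

    card-𝓖≡g : card 𝓖 ≡ g
    card-𝓖≡g = sym (length-map φ (members 𝓖))

    rhs≡ : (2 * ℓ + m) C k + m C k + 2 ≡ A + (M + w 0 + 2)
    rhs≡ = trans (cong₂ (λ a b → a + b + 2) (trans (binomial-by-trace N) split-by-below)
                                             (sym (extensions≡C m z≤n)))
                 (reassociate A M (w 0))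
      where
      reassociate : ∀ a b c → a + b + c + 2 ≡ a + (b + c + 2)
      reassociate = solve-∀

    lhs≡ : card 𝓕 + card 𝓖 + 2 * ((ℓ + m) C k) ≡ card 𝓕 + (g + 2 * X)
    lhs≡ = trans (cong₂ (λ a b → card 𝓕 + a + 2 * b) card-𝓖≡g (binomial-by-trace ℓ))
                 (+-assoc (card 𝓕) g (2 * X))

  bound-≤ : card 𝓕 + card 𝓖 + 2 * ((ℓ + m) C k) ≤ (2 * ℓ + m) C k + m C k + 2
  bound-≤ = subst₂ _≤_ (sym lhs≡) (sym rhs≡) (+-mono-≤ card-𝓕≤ weighted-≤)

  bound-< : 3 ≤ k → card 𝓖 ≢ 2 → card 𝓕 + card 𝓖 + 2 * ((ℓ + m) C k) < (2 * ℓ + m) C k + m C k + 2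
  bound-< 3≤k card-𝓖≢2 = subst₂ _<_ (sym lhs≡) (sym rhs≡) (+-mono-≤-< card-𝓕≤ (weighted-< 3≤g weights))
    where
    3≤g : 3 ≤ g
    3≤g = ≤∧≢⇒< 2≤g (λ 2≡g → card-𝓖≢2 (trans card-𝓖≡g (sym 2≡g)))
    weights : 2 ≤ w ℓ ⊎ (3 ≤ ℓ × 1 ≤ w (pred ℓ))
    weights with ℓ ≟ k
    ... | no ℓ≢k  = inj₁ (subst (2 ≤_) (sym (extensions≡C m ℓ≤k)) (2≤C 1≤k∸ℓ k∸ℓ<m))
      where
      1≤k∸ℓ : 1 ≤ k ∸ ℓ
      1≤k∸ℓ = subst (_< k ∸ ℓ) (n∸n≡0 ℓ) (∸-monoˡ-< (≤∧≢⇒< ℓ≤k ℓ≢k) ≤-refl)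
    ... | yes ℓ≡k = inj₂ (subst (3 ≤_) (sym ℓ≡k) 3≤k , 1≤w[pred-ℓ])
      where
      1≤m : 1 ≤ m
      1≤m = subst (_< m) (m≤n⇒m∸n≡0 (≤-reflexive (sym ℓ≡k))) k∸ℓ<m
      k∸pred-ℓ≡1 : k ∸ pred ℓ ≡ 1
      k∸pred-ℓ≡1 = trans (cong (_∸ pred ℓ) (trans (sym ℓ≡k) (sym (suc-pred ℓ)))) (m+n∸n≡m 1 (pred ℓ))
      w[pred-ℓ]≡m : w (pred ℓ) ≡ m
      w[pred-ℓ]≡m = trans (extensions≡C m (≤-trans pred[n]≤n ℓ≤k))
                          (trans (cong (m C_) k∸pred-ℓ≡1) (nC1≡n m))
      1≤w[pred-ℓ] : 1 ≤ w (pred ℓ)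
      1≤w[pred-ℓ] = subst (1 ≤_) (sym w[pred-ℓ]≡m) 1≤m

2*ℓ+m∸ℓ≡ℓ+m : ∀ ℓ m → 2 * ℓ + m ∸ ℓ ≡ ℓ + m
2*ℓ+m∸ℓ≡ℓ+m ℓ m =
  trans (cong (_∸ ℓ) (+-assoc ℓ (ℓ + 0) m)) (trans (m+n∸m≡n ℓ _) (cong (_+ m) (+-identityʳ ℓ)))

k+ℓ<2*ℓ+m⇒k<ℓ+m : ∀ {k ℓ m} → k + ℓ < 2 * ℓ + m → k < ℓ + m
k+ℓ<2*ℓ+m⇒k<ℓ+m {k} {ℓ} {m} lt = +-cancelʳ-< ℓ k (ℓ + m) (subst (k + ℓ <_) (rearrange ℓ m) lt)
  where
  rearrange : ∀ ℓ m → 2 * ℓ + m ≡ ℓ + m + ℓ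
  rearrange = solve-∀

ℓ≤k∧k+ℓ<n⇒2*ℓ≤n : ∀ {n k ℓ} → ℓ ≤ k → k + ℓ < n → 2 * ℓ ≤ n
ℓ≤k∧k+ℓ<n⇒2*ℓ≤n {n} {k} {ℓ} ℓ≤k k+ℓ<n =
  ≤-trans (+-monoʳ-≤ ℓ (≤-trans (≤-reflexive (+-identityʳ ℓ)) ℓ≤k))
          (<⇒≤ (subst (_< n) (+-comm k ℓ) k+ℓ<n))

proposition4p3 : ∀ (n k ℓ : ℕ) → k + ℓ < n → ℓ ≤ k → 2 ≤ ℓ → 3 ≤ k →
    (𝓕 𝓖 : Family n) → Uniform k 𝓕 → Uniform ℓ 𝓖 → WithinFirst (2 * ℓ) 𝓖 →
    NonTrivial 𝓕 → NonTrivial 𝓖 → CrossIntersecting 𝓕 𝓖 →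
    (card 𝓕 + card 𝓖 + 2 * ((n ∸ ℓ) C k) ≤ n C k + (n ∸ 2 * ℓ) C k + 2)
    × (¬ (card 𝓖 ≡ 2) →
       card 𝓕 + card 𝓖 + 2 * ((n ∸ ℓ) C k) < n C k + (n ∸ 2 * ℓ) C k + 2)
proposition4p3 n k ℓ k+ℓ<n ℓ≤k 2≤ℓ 3≤k 𝓕 𝓖 𝓕-uniform 𝓖-uniform 𝓖-within _ 𝓖-nontrivial cross
  with m≤n⇒∃[o]m+o≡n (ℓ≤k∧k+ℓ<n⇒2*ℓ≤n ℓ≤k k+ℓ<n)
... | m , refl rewrite 2*ℓ+m∸ℓ≡ℓ+m ℓ m | m+n∸m≡n (2 * ℓ) m = bound-≤ , bound-< 3≤k
  where
  instance
    ℓ-nonZero : NonZero ℓ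
    ℓ-nonZero = >-nonZero (≤-trans (s≤s z≤n) 2≤ℓ)
  open Bound ℓ≤k (k+ℓ<2*ℓ+m⇒k<ℓ+m k+ℓ<n) 𝓕 𝓖 𝓕-uniform 𝓖-uniform 𝓖-within 𝓖-nontrivial cross
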